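{- Every 1-truth-table degree except that of the recursive sets contains a set that is compressible by a total recursive function but is not rankable by a total recursive function.
   Context: All sets are subsets of $\Sigma^\ast$ with $\Sigma=\{0,1\}$, with strings ordered lexicographically in the standard computer-science sense ($\epsilon < 0 < 1 < 00 < \cdots$). A (possibly partial) function $f$ is a compression function for a set $A$ if $f$ is defined on every element of $A$, $f(A)=\Sigma^\ast$, and $f$ is injective on $A$ (its behavior on strings outside $A$ is unconstrained). A (possibly partial) function $f$ is a ranking function for $A$ if $f$ is defined on every element of $A$ and, for each $x\in A$, $f(x)$ is the $i$th string of $\Sigma^\ast$ where $x$ is the $i$th string of $A$ (i.e., $f(x)=\|A^{\le x}\|$, the number of elements of $A$ lexicographically at most $x$); again behavior outside $A$ is unconstrained. A set is compressible (resp. rankable) by a total recursive function if some total recursive function from $\Sigma^\ast$ to $\Sigma^\ast$ is a compression (resp. ranking) function for it. $A$ 1-truth-table reduces to $B$ if $A$ is Turing reducible to $B$ via a recursive transducer making at most one query to $B$ on each input; 1-truth-table degrees are the equivalence classes of mutual 1-truth-table reducibility, and the recursive sets form one such degree. -}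

module Defs where

open import Data.Nat using (ℕ; zero; suc; _+_; _<_)
open import Data.Fin using (Fin)
open import Data.Vec using (Vec; []; _∷_; lookup)
open import Data.Bool using (Bool; true; false; not; if_then_else_)
open import Data.Product using (Σ; ∃; _×_)
open import Relation.Binary.PropositionalEquality using (_≡_)
open import Relation.Nullary using (¬_)

-- Strings over Σ = {0,1} are identified with ℕ via the standard
-- length-lexicographic enumeration  ε ↦ 0, 0 ↦ 1, 1 ↦ 2, 00 ↦ 3, …
-- so the order on strings is the order on ℕ.

Lang : Set
Lang = ℕ → Bool

data PR : ℕ → Set where
  zer  : ∀ {n} → PR n
  succ : PR 1
  proj : ∀ {n} → Fin n → PR n
  comp : ∀ {m n} → PR m → (Fin m → PR n) → PR n
  prec : ∀ {n} → PR n → PR (suc (suc n)) → PR (suc n)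
  mu   : ∀ {n} → PR (suc n) → PR n

data Eval : ∀ {n} → PR n → Vec ℕ n → ℕ → Set where
  e-zer  : ∀ {n} {xs : Vec ℕ n} → Eval zer xs 0
  e-succ : ∀ {x} → Eval succ (x ∷ []) (suc x)
  e-proj : ∀ {n} {i : Fin n} {xs} → Eval (proj i) xs (lookup xs i)
  e-comp : ∀ {m n} {f : PR m} {gs : Fin m → PR n} {xs : Vec ℕ n}
             {ys : Vec ℕ m} {z} →
           (∀ i → Eval (gs i) xs (lookup ys i)) →
           Eval f ys z → Eval (comp f gs) xs z
  e-prec0 : ∀ {n} {f : PR n} {g : PR (suc (suc n))} {xs z} →
            Eval f xs z → Eval (prec f g) (0 ∷ xs) z
  e-precS : ∀ {n} {f : PR n} {g : PR (suc (suc n))} {xs k r z} →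
            Eval (prec f g) (k ∷ xs) r →
            Eval g (k ∷ r ∷ xs) z →
            Eval (prec f g) (suc k ∷ xs) z
  e-mu   : ∀ {n} {f : PR (suc n)} {xs y} →
           Eval f (y ∷ xs) 0 →
           (∀ z → z < y → Σ ℕ λ k → Eval f (z ∷ xs) (suc k)) →
           Eval (mu f) xs y

TotalRecursive : (ℕ → ℕ) → Set
TotalRecursive F = Σ (PR 1) λ c → ∀ x → Eval c (x ∷ []) (F x)

χ : Lang → ℕ → ℕ
χ A x = if A x then 1 else 0

RecursiveSet : Lang → Set
RecursiveSet A = TotalRecursive (χ A)

-- 1-truth-table reducibility.  A one-query truth table is one of the
-- four unary Boolean functions (constants false/true cover the case of
-- no query).

tt1 : ℕ → Bool → Bool
tt1 0 b = false
tt1 1 b = true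
tt1 2 b = b
tt1 (suc (suc (suc _))) b = not b

_≤1tt_ : Lang → Lang → Set
A ≤1tt B = Σ (ℕ → ℕ) λ q → Σ (ℕ → ℕ) λ t →
  TotalRecursive q × TotalRecursive t × (∀ x → A x ≡ tt1 (t x) (B (q x)))

_≡1tt_ : Lang → Lang → Set
A ≡1tt B = (A ≤1tt B) × (B ≤1tt A)

IsCompression : (ℕ → ℕ) → Lang → Set
IsCompression f A =
  (∀ x y → A x ≡ true → A y ≡ true → f x ≡ f y → x ≡ y) ×
  (∀ y → Σ ℕ λ x → A x ≡ true × f x ≡ y)

countBelow : Lang → ℕ → ℕ
countBelow A zero = zero
countBelow A (suc x) = countBelow A x + χ A x

-- x is the i-th element of A (counting from 0) ⇒ f x is the i-th
-- string (counting from 0, i.e. the string with code i).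
IsRanking : (ℕ → ℕ) → Lang → Set
IsRanking f A = ∀ x → A x ≡ true → f x ≡ countBelow A x

CompressibleTR : Lang → Set
CompressibleTR A = Σ (ℕ → ℕ) λ f → TotalRecursive f × IsCompression f A

RankableTR : Lang → Set
RankableTR A = Σ (ℕ → ℕ) λ f → TotalRecursive f × IsRanking f A

module Submission where

-- Spread A over the residues mod 3:  B = {3d | d ∈ A} ∪ {3d+1 | d ∈ ℕ} ∪ {3d+2 | d ∉ A}.
-- Both reductions between A and B ask a single query, about d ↔ 3d.  Every block
-- {3d, 3d+1, 3d+2} meets B in exactly two elements, 3d+1 and one of 3d, 3d+2, so
-- sending both 3d and 3d+2 to 2d and 3d+1 to 2d+1 compresses B.  The rank of 3d+1
-- in B, however, is 2d + χ_A(d), so a total recursive ranking function would decide A.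

open import Defs
open import Data.Bool using (true; false; not; if_then_else_)
open import Data.Bool.Properties using (not-¬; not-involutive)
open import Data.Empty using (⊥-elim)
open import Data.Fin using (zero; suc)
open import Data.Nat using (ℕ; zero; suc; _+_; _*_; _∸_; pred)
open import Data.Nat.GeneralisedArithmetic using (fold)
open import Data.Nat.Properties
  using (suc-injective; +-identityʳ; +-comm; *-suc; *-cancelˡ-≡; even≢odd;
         pred[m∸n]≡m∸[1+n]; m+n∸m≡n)
open import Data.Product using (Σ; ∃; _×_; _,_)
open import Data.Sum using (_⊎_; inj₁; inj₂)
open import Data.Vec using (Vec; []; _∷_; lookup)
open import Relation.Binary.PropositionalEquality
open import Relation.Nullary using (¬_)

private
  variable
    n : ℕ
    f g s : ℕ → ℕ

eval-comp₁ : ∀ {f : PR 1} {g : PR n} {xs a z} →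
             Eval g xs a → Eval f (a ∷ []) z → Eval (comp f (λ _ → g)) xs z
eval-comp₁ {a = a} g⇓ f⇓ = e-comp {ys = a ∷ []} (λ { zero → g⇓ }) f⇓

eval-comp₂ : ∀ {f : PR 2} {g h : PR n} {xs a b z} →
             Eval g xs a → Eval h xs b → Eval f (a ∷ b ∷ []) z →
             Eval (comp f (lookup (g ∷ h ∷ []))) xs z
eval-comp₂ {a = a} {b} g⇓ h⇓ f⇓ =
  e-comp {ys = a ∷ b ∷ []} (λ { zero → g⇓ ; (suc zero) → h⇓ }) f⇓

constant : ℕ → PR n
constant zero    = zer
constant (suc c) = comp succ (λ _ → constant c)

constant-eval : ∀ {xs : Vec ℕ n} c → Eval (constant c) xs c
constant-eval zero    = e-zer
constant-eval (suc c) = eval-comp₁ (constant-eval c) e-succ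

plus : PR 2
plus = prec (proj zero) (comp succ (λ _ → proj (suc zero)))

plus-eval : ∀ a b → Eval plus (a ∷ b ∷ []) (a + b)
plus-eval zero    b = e-prec0 e-proj
plus-eval (suc a) b = e-precS (plus-eval a b) (eval-comp₁ e-proj e-succ)

predecessor : PR 1
predecessor = prec zer (proj zero)

predecessor-eval : ∀ a → Eval predecessor (a ∷ []) (pred a)
predecessor-eval zero    = e-prec0 e-zer
predecessor-eval (suc a) = e-precS (predecessor-eval a) e-proj

-- Arguments in reverse order: the recursion runs on the subtrahend.
monus : PR 2
monus = prec (proj zero) (comp predecessor (λ _ → proj (suc zero)))

monus-eval : ∀ b a → Eval monus (b ∷ a ∷ []) (a ∸ b)
monus-eval zero    a = e-prec0 e-proj
monus-eval (suc b) a = subst (Eval monus (suc b ∷ a ∷ [])) (pred[m∸n]≡m∸[1+n] a b)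
  (e-precS (monus-eval b a) (eval-comp₁ e-proj (predecessor-eval (a ∸ b))))

TotalRecursive-resp : (∀ x → f x ≡ g x) → TotalRecursive f → TotalRecursive g
TotalRecursive-resp f≗g (c , c⇓) = c , λ x → subst (Eval c (x ∷ [])) (f≗g x) (c⇓ x)

id-rec : TotalRecursive (λ x → x)
id-rec = proj zero , λ _ → e-proj

const-rec : ∀ c → TotalRecursive (λ _ → c)
const-rec c = constant c , λ _ → constant-eval c

suc-rec : TotalRecursive suc
suc-rec = succ , λ _ → e-succ

∘-rec : TotalRecursive f → TotalRecursive g → TotalRecursive (λ x → f (g x))
∘-rec (c , c⇓) (d , d⇓) = comp c (λ _ → d) , λ x → eval-comp₁ (d⇓ x) (c⇓ _)

+-rec : TotalRecursive f → TotalRecursive g → TotalRecursive (λ x → f x + g x)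
+-rec (c , c⇓) (d , d⇓) =
  comp plus (lookup (c ∷ d ∷ [])) , λ x → eval-comp₂ (c⇓ x) (d⇓ x) (plus-eval _ _)

∸-rec : TotalRecursive f → TotalRecursive g → TotalRecursive (λ x → f x ∸ g x)
∸-rec (c , c⇓) (d , d⇓) =
  comp monus (lookup (d ∷ c ∷ [])) , λ x → eval-comp₂ (d⇓ x) (c⇓ x) (monus-eval _ _)

*-rec : ∀ k → TotalRecursive (k *_)
*-rec zero    = const-rec 0
*-rec (suc k) = +-rec id-rec (*-rec k)

fold-rec : ∀ z → TotalRecursive s → TotalRecursive (fold z s)
fold-rec z (c , c⇓) = prec (constant z) step , step⇓
  where
  step : PR 2
  step = comp c (λ _ → proj (suc zero))
  step⇓ : ∀ y → Eval (prec (constant z) step) (y ∷ []) (fold z _ y)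
  step⇓ zero    = e-prec0 (constant-eval z)
  step⇓ (suc y) = e-precS (step⇓ y) (eval-comp₁ e-proj (c⇓ _))

sumBelow : (ℕ → ℕ) → ℕ → ℕ
sumBelow g zero    = 0
sumBelow g (suc y) = sumBelow g y + g y

sumBelow-rec : TotalRecursive g → TotalRecursive (sumBelow g)
sumBelow-rec (c , c⇓) = prec zer step , step⇓
  where
  step : PR 2
  step = comp plus (lookup (proj (suc zero) ∷ comp c (λ _ → proj zero) ∷ []))
  step⇓ : ∀ y → Eval (prec zer step) (y ∷ []) (sumBelow _ y)
  step⇓ zero    = e-prec0 e-zer
  step⇓ (suc y) =
    e-precS (step⇓ y) (eval-comp₂ e-proj (eval-comp₁ e-proj (c⇓ y)) (plus-eval _ _))

-- Arithmetic on residues, only meaningful on 0, 1, 2: next3 cycles 0 ↦ 1 ↦ 2 ↦ 0,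
-- isOne is the indicator of 1, and table picks the truth table of tt1 for the
-- residue (0 ↦ identity, 1 ↦ constant true, 2 ↦ negation).
next3 isOne table : ℕ → ℕ
next3 r = suc r ∸ 3 * (r ∸ 1)
isOne r = r ∸ 2 * (r ∸ 1)
table r = (2 ∸ r) + 3 * (r ∸ 1)

pred-rec : TotalRecursive (_∸ 1)
pred-rec = ∸-rec id-rec (const-rec 1)

next3-rec : TotalRecursive next3
next3-rec = ∸-rec suc-rec (∘-rec (*-rec 3) pred-rec)

isOne-rec : TotalRecursive isOne
isOne-rec = ∸-rec id-rec (∘-rec (*-rec 2) pred-rec)

table-rec : TotalRecursive table
table-rec = +-rec (∸-rec (const-rec 2) id-rec) (∘-rec (*-rec 3) pred-rec)

mod3 : ℕ → ℕ
mod3 = fold 0 next3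

div3 : ℕ → ℕ
div3 = sumBelow (λ i → mod3 i ∸ 1)

mod3-rec : TotalRecursive mod3
mod3-rec = fold-rec 0 next3-rec

div3-rec : TotalRecursive div3
div3-rec = sumBelow-rec (∘-rec pred-rec mod3-rec)

data Mod3View : ℕ → Set where
  rem0 : ∀ d → Mod3View (3 * d)
  rem1 : ∀ d → Mod3View (suc (3 * d))
  rem2 : ∀ d → Mod3View (suc (suc (3 * d)))

mod3View : ∀ y → Mod3View y
mod3View zero = rem0 0
mod3View (suc y) with mod3View y
... | rem0 d = rem1 d
... | rem1 d = rem2 d
... | rem2 d = subst Mod3View (*-suc 3 d) (rem0 (suc d))

quotient residue : ∀ {y} → Mod3View y → ℕ
quotient (rem0 d) = d
quotient (rem1 d) = d
quotient (rem2 d) = d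
residue (rem0 _) = 0
residue (rem1 _) = 1
residue (rem2 _) = 2

mod3-3* : ∀ d → mod3 (3 * d) ≡ 0
mod3-3* zero = refl
mod3-3* (suc d) =
  trans (cong mod3 (*-suc 3 d)) (cong (λ r → next3 (next3 (next3 r))) (mod3-3* d))

div3-3* : ∀ d → div3 (3 * d) ≡ d
div3-3* zero = refl
div3-3* (suc d) = begin
  div3 (3 * suc d)                      ≡⟨ cong div3 (*-suc 3 d) ⟩
  div3 (suc (suc (suc (3 * d))))        ≡⟨ cong₂ (λ q r → q + (r ∸ 1) + (next3 r ∸ 1) + (next3 (next3 r) ∸ 1))
                                                 (div3-3* d) (mod3-3* d) ⟩
  d + 0 + 0 + 1                         ≡⟨ cong (λ k → k + 0 + 1) (+-identityʳ d) ⟩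
  d + 0 + 1                             ≡⟨ cong (_+ 1) (+-identityʳ d) ⟩
  d + 1                                 ≡⟨ +-comm d 1 ⟩
  suc d                                 ∎
  where open ≡-Reasoning

mod3-view : ∀ {y} (v : Mod3View y) → mod3 y ≡ residue v
mod3-view (rem0 d) = mod3-3* d
mod3-view (rem1 d) = cong next3 (mod3-3* d)
mod3-view (rem2 d) = cong (λ r → next3 (next3 r)) (mod3-3* d)

div3-view : ∀ {y} (v : Mod3View y) → div3 y ≡ quotient v
div3-view (rem0 d) = div3-3* d
div3-view (rem1 d) rewrite mod3-3* d | div3-3* d = +-identityʳ d
div3-view (rem2 d) rewrite mod3-3* d | div3-3* d | +-identityʳ d = +-identityʳ d

tripleSet : Lang → Lang
tripleSet A y = tt1 (table (mod3 y)) (A (div3 y))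

tripleSet-view : ∀ A {y} (v : Mod3View y) →
                 tripleSet A y ≡ tt1 (table (residue v)) (A (quotient v))
tripleSet-view A v rewrite mod3-view v | div3-view v = refl

compress : ℕ → ℕ
compress y = isOne (mod3 y) + 2 * div3 y

compress-rec : TotalRecursive compress
compress-rec = +-rec (∘-rec isOne-rec mod3-rec) (∘-rec (*-rec 2) div3-rec)

compress-view : ∀ {y} (v : Mod3View y) → compress y ≡ isOne (residue v) + 2 * quotient v
compress-view v rewrite mod3-view v | div3-view v = refl

tripleSet-ends : ∀ A d → tripleSet A (3 * d) ≡ not (tripleSet A (suc (suc (3 * d))))
tripleSet-ends A d = begin
  tripleSet A (3 * d)                  ≡⟨ tripleSet-view A (rem0 d) ⟩
  A d                                  ≡⟨ not-involutive (A d) ⟨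
  not (not (A d))                      ≡⟨ cong not (tripleSet-view A (rem2 d)) ⟨
  not (tripleSet A (suc (suc (3 * d)))) ∎
  where open ≡-Reasoning

compress-injective : ∀ A x y → tripleSet A x ≡ true → tripleSet A y ≡ true →
                     compress x ≡ compress y → x ≡ y
compress-injective A x y x∈B y∈B eq =
  on-views (mod3View x) (mod3View y) x∈B y∈B
    (trans (sym (compress-view (mod3View x))) (trans eq (compress-view (mod3View y))))
  where
  halve : ∀ a b → 2 * a ≡ 2 * b → a ≡ b
  halve a b = *-cancelˡ-≡ a b 2
  ends-exclusive : ∀ d → tripleSet A (3 * d) ≡ true → tripleSet A (suc (suc (3 * d))) ≢ true
  ends-exclusive d ∈B ∈B′ = not-¬ (sym ∈B′) (trans (sym ∈B) (tripleSet-ends A d))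
  on-views : ∀ {x y} (v : Mod3View x) (w : Mod3View y) →
             tripleSet A x ≡ true → tripleSet A y ≡ true →
             isOne (residue v) + 2 * quotient v ≡ isOne (residue w) + 2 * quotient w → x ≡ y
  on-views (rem0 a) (rem0 b) _ _ e = cong (3 *_) (halve a b e)
  on-views (rem0 a) (rem1 b) _ _ e = ⊥-elim (even≢odd a b e)
  on-views (rem0 a) (rem2 b) ∈B ∈B′ e with refl ← halve a b e = ⊥-elim (ends-exclusive a ∈B ∈B′)
  on-views (rem1 a) (rem0 b) _ _ e = ⊥-elim (even≢odd b a (sym e))
  on-views (rem1 a) (rem1 b) _ _ e = cong (λ k → suc (3 * k)) (halve a b (suc-injective e))
  on-views (rem1 a) (rem2 b) _ _ e = ⊥-elim (even≢odd b a (sym e))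
  on-views (rem2 a) (rem0 b) ∈B ∈B′ e with refl ← halve a b e = ⊥-elim (ends-exclusive a ∈B′ ∈B)
  on-views (rem2 a) (rem1 b) _ _ e = ⊥-elim (even≢odd a b e)
  on-views (rem2 a) (rem2 b) _ _ e = cong (λ k → suc (suc (3 * k))) (halve a b e)

even⊎odd : ∀ m → ∃ λ d → m ≡ 2 * d ⊎ m ≡ suc (2 * d)
even⊎odd zero = 0 , inj₁ refl
even⊎odd (suc m) with even⊎odd m
... | d , inj₁ m≡2d = d , inj₂ (cong suc m≡2d)
... | d , inj₂ m≡1+2d = suc d , inj₁ (trans (cong suc m≡1+2d) (sym (*-suc 2 d)))

compress-surjective : ∀ A m → ∃ λ x → tripleSet A x ≡ true × compress x ≡ m
compress-surjective A m with even⊎odd m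
... | d , inj₂ m≡1+2d = suc (3 * d) , tripleSet-view A (rem1 d)
                                    , trans (compress-view (rem1 d)) (sym m≡1+2d)
... | d , inj₁ m≡2d with A d in d∈A
...   | true  = 3 * d , trans (tripleSet-view A (rem0 d)) d∈A
                      , trans (compress-view (rem0 d)) (sym m≡2d)
...   | false = suc (suc (3 * d)) , trans (tripleSet-view A (rem2 d)) (cong not d∈A)
                                  , trans (compress-view (rem2 d)) (sym m≡2d)

tripleSet-compressible : ∀ A → CompressibleTR (tripleSet A)
tripleSet-compressible A = compress , compress-rec , compress-injective A , compress-surjective A

countBelow-block : ∀ (B : Lang) y → B y ≡ not (B (suc (suc y))) → B (suc y) ≡ true →
                   countBelow B (3 + y) ≡ 2 + countBelow B y
countBelow-block B y y∈B 1+y∈B rewrite y∈B | 1+y∈B =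
  two-of-three (countBelow B y) (B (suc (suc y)))
  where
  two-of-three : ∀ m b → m + (if not b then 1 else 0) + 1 + (if b then 1 else 0) ≡ 2 + m
  two-of-three zero    true  = refl
  two-of-three zero    false = refl
  two-of-three (suc m) b     = cong suc (two-of-three m b)

countBelow-3* : ∀ A d → countBelow (tripleSet A) (3 * d) ≡ 2 * d
countBelow-3* A zero    = refl
countBelow-3* A (suc d) = begin
  countBelow (tripleSet A) (3 * suc d)   ≡⟨ cong (countBelow (tripleSet A)) (*-suc 3 d) ⟩
  countBelow (tripleSet A) (3 + 3 * d)   ≡⟨ countBelow-block (tripleSet A) (3 * d)
                                              (tripleSet-ends A d) (tripleSet-view A (rem1 d)) ⟩
  2 + countBelow (tripleSet A) (3 * d)   ≡⟨ cong (2 +_) (countBelow-3* A d) ⟩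
  2 + 2 * d                              ≡⟨ *-suc 2 d ⟨
  2 * suc d                              ∎
  where open ≡-Reasoning

countBelow-1+3* : ∀ A d → countBelow (tripleSet A) (suc (3 * d)) ≡ 2 * d + χ A d
countBelow-1+3* A d rewrite countBelow-3* A d | tripleSet-view A (rem0 d) = refl

tripleSet-unrankable : ∀ A → ¬ RecursiveSet A → ¬ RankableTR (tripleSet A)
tripleSet-unrankable A ¬rec (F , F-rec , F-ranks) =
  ¬rec (TotalRecursive-resp rank-decides
         (∸-rec (∘-rec F-rec (∘-rec suc-rec (*-rec 3))) (*-rec 2)))
  where
  rank-decides : ∀ d → F (suc (3 * d)) ∸ 2 * d ≡ χ A d
  rank-decides d = begin
    F (suc (3 * d)) ∸ 2 * d                         ≡⟨ cong (_∸ 2 * d) (F-ranks _ (tripleSet-view A (rem1 d))) ⟩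
    countBelow (tripleSet A) (suc (3 * d)) ∸ 2 * d  ≡⟨ cong (_∸ 2 * d) (countBelow-1+3* A d) ⟩
    2 * d + χ A d ∸ 2 * d                           ≡⟨ m+n∸m≡n (2 * d) (χ A d) ⟩
    χ A d                                           ∎
    where open ≡-Reasoning

≤1tt-tripleSet : ∀ A → A ≤1tt tripleSet A
≤1tt-tripleSet A =
  (3 *_) , (λ _ → 2) , *-rec 3 , const-rec 2 , λ d → sym (tripleSet-view A (rem0 d))

tripleSet-≤1tt : ∀ A → tripleSet A ≤1tt A
tripleSet-≤1tt A = div3 , (λ y → table (mod3 y)) , div3-rec , ∘-rec table-rec mod3-rec , λ _ → refl

theorem8 : (A : Lang) → ¬ RecursiveSet A →
    Σ Lang (λ B → (A ≡1tt B) × CompressibleTR B × ¬ RankableTR B)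
theorem8 A ¬rec =
  tripleSet A , (≤1tt-tripleSet A , tripleSet-≤1tt A) ,
  tripleSet-compressible A , tripleSet-unrankable A ¬rec
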